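{- Let $\mathbf A$ be a semi-Heyting algebra. Then $\mathbf A$ is anti-Boolean if and only if $\mathbf A$ satisfies (i) $(x^*\to x)^*\approx1$ and (ii) $x^*\vee y^*\vee(x\to y)\approx1$.
   Context: A semi-Heyting algebra is an algebra $\langle A;\wedge,\vee,\to,0,1\rangle$ such that $\langle A;\wedge,\vee,0,1\rangle$ is a bounded lattice and the identities $x\wedge(x\to y)\approx x\wedge y$, $x\wedge(y\to z)\approx x\wedge((x\wedge y)\to(x\wedge z))$, $x\to x\approx1$ hold. Write $x^*:=x\to0$. $\bar{\mathbf 2}$ is the semi-Heyting algebra on the chain $0<1$ with $0\to0=1$, $0\to1=0$, $1\to0=0$, $1\to1=1$; a semi-Heyting algebra is anti-Boolean if it belongs to the variety generated by $\bar{\mathbf 2}$. -}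

module Defs where

open import Level using (Level; suc)
open import Data.Nat using (ℕ)
open import Data.Bool using (Bool; true; false)
import Data.Bool as B
import Data.Bool.Properties as BP
open import Relation.Binary.PropositionalEquality using (_≡_; refl)
open import Algebra.Lattice.Structures using (IsLattice)

record SemiHeytingAlgebra (a : Level) : Set (suc a) where
  infixr 8 _∧_
  infixr 7 _∨_
  infixr 6 _⇒_
  infix 9 _*
  field
    Carrier : Set a
    _∧_ _∨_ _⇒_ : Carrier → Carrier → Carrier
    𝟘 𝟙 : Carrier
    isLattice : IsLattice _≡_ _∨_ _∧_
    𝟘-bottom : ∀ x → 𝟘 ∧ x ≡ 𝟘
    𝟙-top    : ∀ x → 𝟙 ∨ x ≡ 𝟙
    sh₁ : ∀ x y → x ∧ (x ⇒ y) ≡ x ∧ y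
    sh₂ : ∀ x y z → x ∧ (y ⇒ z) ≡ x ∧ ((x ∧ y) ⇒ (x ∧ z))
    sh₃ : ∀ x → x ⇒ x ≡ 𝟙

  _* : Carrier → Carrier
  x * = x ⇒ 𝟘

data Term : Set where
  var : ℕ → Term
  _∧ₜ_ _∨ₜ_ _⇒ₜ_ : Term → Term → Term
  𝟘ₜ 𝟙ₜ : Term

module _ {a : Level} (A : SemiHeytingAlgebra a) where
  open SemiHeytingAlgebra A

  ⟦_⟧ : Term → (ℕ → Carrier) → Carrier
  ⟦ var i ⟧ ρ = ρ i
  ⟦ s ∧ₜ t ⟧ ρ = ⟦ s ⟧ ρ ∧ ⟦ t ⟧ ρ
  ⟦ s ∨ₜ t ⟧ ρ = ⟦ s ⟧ ρ ∨ ⟦ t ⟧ ρ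
  ⟦ s ⇒ₜ t ⟧ ρ = ⟦ s ⟧ ρ ⇒ ⟦ t ⟧ ρ
  ⟦ 𝟘ₜ ⟧ ρ = 𝟘
  ⟦ 𝟙ₜ ⟧ ρ = 𝟙

  _⊨_≈_ : Term → Term → Set a
  _⊨_≈_ s t = ∀ (ρ : ℕ → Carrier) → ⟦ s ⟧ ρ ≡ ⟦ t ⟧ ρ

-- The algebra 2̄ on the chain 0 < 1: 0→0=1, 0→1=0, 1→0=0, 1→1=1
-- (i.e. x → y is "x ↔ y").
_⇒₂_ : Bool → Bool → Bool
false ⇒₂ false = true
false ⇒₂ true  = false
true  ⇒₂ false = false
true  ⇒₂ true  = true

2̄ : SemiHeytingAlgebra Level.zero
2̄ = record
  { Carrier = Bool
  ; _∧_ = B._∧_ ; _∨_ = B._∨_ ; _⇒_ = _⇒₂_ ; 𝟘 = false ; 𝟙 = true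
  ; isLattice = BP.∨-∧-isLattice
  ; 𝟘-bottom = λ _ → refl
  ; 𝟙-top = λ _ → refl
  ; sh₁ = sh₁' ; sh₂ = sh₂' ; sh₃ = sh₃' }
  where
  sh₁' : ∀ x y → x B.∧ (x ⇒₂ y) ≡ x B.∧ y
  sh₁' false y = refl
  sh₁' true false = refl
  sh₁' true true = refl
  sh₂' : ∀ x y z → x B.∧ (y ⇒₂ z) ≡ x B.∧ ((x B.∧ y) ⇒₂ (x B.∧ z))
  sh₂' false y z = refl
  sh₂' true false false = refl
  sh₂' true false true = refl
  sh₂' true true false = refl
  sh₂' true true true = refl
  sh₃' : ∀ x → x ⇒₂ x ≡ true
  sh₃' false = refl
  sh₃' true = refl

-- A is anti-Boolean: A lies in the variety V(2̄) generated by 2̄, i.e. the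
-- equational class of all identities valid in 2̄: A satisfies every identity
-- that holds in 2̄.
IsAntiBoolean : ∀ {a} → SemiHeytingAlgebra a → Set a
IsAntiBoolean A = ∀ (s t : Term) → 2̄ ⊨ s ≈ t → A ⊨ s ≈ t

{-# OPTIONS --safe #-}

-- In a semi-Heyting algebra x ⇒ (x ∧ y) is a Heyting implication, so the
-- lattice is distributive, and then sh₂ makes  e ∧ x ≡ e ∧ y  a congruence
-- for every e. Identity (i) at x = 1 gives 0 → 1 = 0, so {0, 1} is a
-- subalgebra isomorphic to 2̄; identity (ii) at x = 1 gives x ∨ x* = 1.
-- Splitting 1 along v ∨ v* for every variable v of an identity valid in 2̄
-- yields pieces e on which each variable is congruent to 0 or 1, and there
-- the identity reduces to an evaluation in {0, 1} ≅ 2̄.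

module Submission where

open import Defs
open import Level using (Level)
open import Algebra.Bundles using (CommutativeSemigroup)
open import Algebra.Lattice.Bundles using (Lattice)
open import Algebra.Lattice.Structures using (IsLattice)
import Algebra.Lattice.Properties.Lattice as LatticeProperties
import Algebra.Properties.CommutativeSemigroup as CommutativeSemigroupProperties
open import Data.Bool using (Bool; true; false)
import Data.Bool as B
open import Data.List using (List; []; _∷_; _++_)
open import Data.List.Membership.Propositional using (_∈_; _∉_)
open import Data.List.Membership.Propositional.Properties using (∈-++⁺ˡ; ∈-++⁺ʳ)
open import Data.List.Relation.Unary.Any using (here; there)
open import Data.Nat using (ℕ; zero; suc; _≟_)
open import Data.Product using (_×_; _,_)
open import Function using (_∘_)
open import Function.Bundles using (_⇔_; mk⇔)
open import Relation.Binary.Bundles using (Poset)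
import Relation.Binary.Lattice as OrderLattice
import Relation.Binary.Lattice.Properties.BoundedJoinSemilattice as BoundedJoinSemilatticeProperties
import Relation.Binary.Lattice.Properties.BoundedLattice as BoundedLatticeProperties
import Relation.Binary.Lattice.Properties.HeytingAlgebra as HeytingAlgebraProperties
open import Relation.Binary.PropositionalEquality
  using (_≡_; refl; sym; trans; cong; cong₂; module ≡-Reasoning)
open import Relation.Nullary using (yes; no; contradiction)

vars : Term → List ℕ
vars (var i)  = i ∷ []
vars (s ∧ₜ t) = vars s ++ vars t
vars (s ∨ₜ t) = vars s ++ vars t
vars (s ⇒ₜ t) = vars s ++ vars t
vars 𝟘ₜ       = []
vars 𝟙ₜ       = []

_*ₜ : Term → Term
t *ₜ = t ⇒ₜ 𝟘ₜ

term-i : Term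
term-i = ((var 0 *ₜ) ⇒ₜ var 0) *ₜ

term-ii : Term
term-ii = (var 0 *ₜ) ∨ₜ ((var 1 *ₜ) ∨ₜ (var 0 ⇒ₜ var 1))

2̄⊨term-i : 2̄ ⊨ term-i ≈ 𝟙ₜ
2̄⊨term-i ρ with ρ 0
... | false = refl
... | true  = refl

2̄⊨term-ii : 2̄ ⊨ term-ii ≈ 𝟙ₜ
2̄⊨term-ii ρ with ρ 0 | ρ 1
... | false | false = refl
... | false | true  = refl
... | true  | false = refl
... | true  | true  = refl

_[_≔_] : (ℕ → Bool) → ℕ → Bool → ℕ → Bool
(σ [ j ≔ b ]) i with i ≟ j
... | yes _ = b
... | no  _ = σ i

⟦_⟧₂ : Term → (ℕ → Bool) → Bool
⟦_⟧₂ = ⟦_⟧ 2̄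

module _ {a : Level} (A : SemiHeytingAlgebra a) where
  open SemiHeytingAlgebra A
  open IsLattice isLattice using (∧-comm; ∧-assoc; ∨-comm; ∧-absorbs-∨)
  open ≡-Reasoning

  ⟦_⟧ᴬ : Term → (ℕ → Carrier) → Carrier
  ⟦_⟧ᴬ = ⟦_⟧ A

  Identity-i : Set a
  Identity-i = ∀ x → ((x *) ⇒ x) * ≡ 𝟙

  Identity-ii : Set a
  Identity-ii = ∀ x y → (x *) ∨ (y *) ∨ (x ⇒ y) ≡ 𝟙

  antiBoolean⇒identities : IsAntiBoolean A → Identity-i × Identity-ii
  antiBoolean⇒identities antiBoolean =
    (λ x → antiBoolean term-i 𝟙ₜ 2̄⊨term-i (λ _ → x)) ,
    (λ x y → antiBoolean term-ii 𝟙ₜ 2̄⊨term-ii λ { zero → x ; (suc _) → y })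

  lattice : Lattice a a
  lattice = record
    { Carrier = Carrier ; _≈_ = _≡_ ; _∨_ = _∨_ ; _∧_ = _∧_ ; isLattice = isLattice }

  open LatticeProperties lattice using (∧-idem; ∧-isSemigroup; poset; ∨-∧-isOrderTheoreticLattice)
  open Poset poset using (_≤_)

  ∧-commutativeSemigroup : CommutativeSemigroup a a
  ∧-commutativeSemigroup = record
    { Carrier = Carrier ; _≈_ = _≡_ ; _∙_ = _∧_
    ; isCommutativeSemigroup = record { isSemigroup = ∧-isSemigroup ; comm = ∧-comm }
    }

  open CommutativeSemigroupProperties ∧-commutativeSemigroup using (interchange; xy∙z≈xz∙y)

  ∧-identityʳ : ∀ x → x ∧ 𝟙 ≡ x
  ∧-identityʳ x = trans (cong (x ∧_) (trans (sym (𝟙-top x)) (∨-comm 𝟙 x))) (∧-absorbs-∨ x 𝟙)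

  ∧-identityˡ : ∀ x → 𝟙 ∧ x ≡ x
  ∧-identityˡ x = trans (∧-comm 𝟙 x) (∧-identityʳ x)

  ⇒-identityˡ : ∀ x → 𝟙 ⇒ x ≡ x
  ⇒-identityˡ x = begin
    𝟙 ⇒ x        ≡⟨ ∧-identityˡ (𝟙 ⇒ x) ⟨
    𝟙 ∧ (𝟙 ⇒ x)  ≡⟨ sh₁ 𝟙 x ⟩
    𝟙 ∧ x        ≡⟨ ∧-identityˡ x ⟩
    x            ∎

  infixr 6 _⇒ʰ_
  _⇒ʰ_ : Carrier → Carrier → Carrier
  x ⇒ʰ y = x ⇒ (x ∧ y)

  ∧≤⇒≤⇒ʰ : ∀ w x y → w ∧ x ≤ y → w ≤ x ⇒ʰ y
  ∧≤⇒≤⇒ʰ w x y wx≤y = sym (begin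
    w ∧ (x ⇒ (x ∧ y))              ≡⟨ sh₂ w x (x ∧ y) ⟩
    w ∧ ((w ∧ x) ⇒ (w ∧ (x ∧ y)))  ≡⟨ cong (λ z → w ∧ ((w ∧ x) ⇒ z)) w∧[x∧y]≡w∧x ⟩
    w ∧ ((w ∧ x) ⇒ (w ∧ x))        ≡⟨ cong (w ∧_) (sh₃ (w ∧ x)) ⟩
    w ∧ 𝟙                          ≡⟨ ∧-identityʳ w ⟩
    w                              ∎)
    where
    w∧[x∧y]≡w∧x : w ∧ (x ∧ y) ≡ w ∧ x
    w∧[x∧y]≡w∧x = trans (sym (∧-assoc w x y)) (sym wx≤y)

  ≤⇒ʰ⇒∧≤ : ∀ w x y → w ≤ x ⇒ʰ y → w ∧ x ≤ y
  ≤⇒ʰ⇒∧≤ w x y w≤x⇒ʰy = begin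
    w ∧ x                      ≡⟨ cong (_∧ x) w≤x⇒ʰy ⟩
    (w ∧ (x ⇒ʰ y)) ∧ x         ≡⟨ xy∙z≈xz∙y w (x ⇒ʰ y) x ⟩
    (w ∧ x) ∧ (x ⇒ (x ∧ y))    ≡⟨ ∧-assoc w x _ ⟩
    w ∧ (x ∧ (x ⇒ (x ∧ y)))    ≡⟨ cong (w ∧_) (sh₁ x (x ∧ y)) ⟩
    w ∧ (x ∧ (x ∧ y))          ≡⟨ cong (w ∧_) x∧[x∧y]≡x∧y ⟩
    w ∧ (x ∧ y)                ≡⟨ ∧-assoc w x y ⟨
    (w ∧ x) ∧ y                ∎
    where
    x∧[x∧y]≡x∧y : x ∧ (x ∧ y) ≡ x ∧ y
    x∧[x∧y]≡x∧y = trans (sym (∧-assoc x x y)) (cong (_∧ y) (∧-idem x))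

  heytingAlgebra : OrderLattice.HeytingAlgebra a a a
  heytingAlgebra = record
    { Carrier = Carrier ; _≈_ = _≡_ ; _≤_ = _≤_
    ; _∨_ = _∨_ ; _∧_ = _∧_ ; _⇨_ = _⇒ʰ_ ; ⊤ = 𝟙 ; ⊥ = 𝟘
    ; isHeytingAlgebra = record
      { isBoundedLattice = record
        { isLattice = ∨-∧-isOrderTheoreticLattice
        ; maximum   = λ x → sym (∧-identityʳ x)
        ; minimum   = λ x → sym (𝟘-bottom x)
        }
      ; exponential = λ w x y → ∧≤⇒≤⇒ʰ w x y , ≤⇒ʰ⇒∧≤ w x y
      }
    }

  open OrderLattice.HeytingAlgebra heytingAlgebra using (boundedLattice; boundedJoinSemilattice)
  open HeytingAlgebraProperties heytingAlgebra using (∧-distribˡ-∨)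
  open BoundedLatticeProperties boundedLattice using (∧-zeroʳ)
  open BoundedJoinSemilatticeProperties boundedJoinSemilattice renaming (identityˡ to ∨-identityˡ)

  x*≡𝟙⇒x≡𝟘 : ∀ x → x * ≡ 𝟙 → x ≡ 𝟘
  x*≡𝟙⇒x≡𝟘 x x*≡𝟙 = begin
    x            ≡⟨ ∧-identityʳ x ⟨
    x ∧ 𝟙        ≡⟨ cong (x ∧_) x*≡𝟙 ⟨
    x ∧ (x ⇒ 𝟘)  ≡⟨ sh₁ x 𝟘 ⟩
    x ∧ 𝟘        ≡⟨ ∧-zeroʳ x ⟩
    𝟘            ∎

  identity-i⇒𝟘⇒𝟙≡𝟘 : Identity-i → 𝟘 ⇒ 𝟙 ≡ 𝟘
  identity-i⇒𝟘⇒𝟙≡𝟘 identity-i = x*≡𝟙⇒x≡𝟘 (𝟘 ⇒ 𝟙) (begin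
    (𝟘 ⇒ 𝟙) *      ≡⟨ cong (λ z → (z ⇒ 𝟙) *) (⇒-identityˡ 𝟘) ⟨
    (𝟙 * ⇒ 𝟙) *    ≡⟨ identity-i 𝟙 ⟩
    𝟙              ∎)

  identity-ii⇒∨-complementʳ : Identity-ii → ∀ x → x ∨ x * ≡ 𝟙
  identity-ii⇒∨-complementʳ identity-ii x = begin
    x ∨ x *                   ≡⟨ ∨-comm x (x *) ⟩
    x * ∨ x                   ≡⟨ ∨-identityˡ (x * ∨ x) ⟨
    𝟘 ∨ x * ∨ x               ≡⟨ cong₂ (λ u v → u ∨ x * ∨ v) (⇒-identityˡ 𝟘) (⇒-identityˡ x) ⟨
    𝟙 * ∨ x * ∨ (𝟙 ⇒ x)       ≡⟨ identity-ii 𝟙 x ⟩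
    𝟙                         ∎

  infix 4 _≈[_]_
  _≈[_]_ : Carrier → Carrier → Carrier → Set a
  x ≈[ e ] y = e ∧ x ≡ e ∧ y

  ≈[𝟙]⇒≡ : ∀ {x y} → x ≈[ 𝟙 ] y → x ≡ y
  ≈[𝟙]⇒≡ {x} {y} x≈y = trans (sym (∧-identityˡ x)) (trans x≈y (∧-identityˡ y))

  ≈-restrict : ∀ {e x y} f → x ≈[ e ] y → x ≈[ e ∧ f ] y
  ≈-restrict {e} {x} {y} f x≈y = begin
    (e ∧ f) ∧ x  ≡⟨ xy∙z≈xz∙y e f x ⟩
    (e ∧ x) ∧ f  ≡⟨ cong (_∧ f) x≈y ⟩
    (e ∧ y) ∧ f  ≡⟨ xy∙z≈xz∙y e y f ⟩
    (e ∧ f) ∧ y  ∎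

  ∧-cong-≈ : ∀ {e x x′ y y′} → x ≈[ e ] x′ → y ≈[ e ] y′ → x ∧ y ≈[ e ] x′ ∧ y′
  ∧-cong-≈ {e} {x} {x′} {y} {y′} x≈x′ y≈y′ = begin
    e ∧ (x ∧ y)        ≡⟨ cong (_∧ (x ∧ y)) (∧-idem e) ⟨
    (e ∧ e) ∧ (x ∧ y)  ≡⟨ interchange e e x y ⟩
    (e ∧ x) ∧ (e ∧ y)  ≡⟨ cong₂ _∧_ x≈x′ y≈y′ ⟩
    (e ∧ x′) ∧ (e ∧ y′) ≡⟨ interchange e x′ e y′ ⟩
    (e ∧ e) ∧ (x′ ∧ y′) ≡⟨ cong (_∧ (x′ ∧ y′)) (∧-idem e) ⟩
    e ∧ (x′ ∧ y′)      ∎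

  ∨-cong-≈ : ∀ {e x x′ y y′} → x ≈[ e ] x′ → y ≈[ e ] y′ → x ∨ y ≈[ e ] x′ ∨ y′
  ∨-cong-≈ {e} x≈x′ y≈y′ =
    trans (∧-distribˡ-∨ e _ _) (trans (cong₂ _∨_ x≈x′ y≈y′) (sym (∧-distribˡ-∨ e _ _)))

  ⇒-cong-≈ : ∀ {e x x′ y y′} → x ≈[ e ] x′ → y ≈[ e ] y′ → x ⇒ y ≈[ e ] x′ ⇒ y′
  ⇒-cong-≈ {e} x≈x′ y≈y′ =
    trans (sh₂ e _ _) (trans (cong₂ (λ u v → e ∧ (u ⇒ v)) x≈x′ y≈y′) (sym (sh₂ e _ _)))

  ⟦⟧-cong-≈ : ∀ {e ρ ρ′} t → (∀ {i} → i ∈ vars t → ρ i ≈[ e ] ρ′ i) →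
              ⟦ t ⟧ᴬ ρ ≈[ e ] ⟦ t ⟧ᴬ ρ′
  ⟦⟧-cong-≈ (var i)  h = h (here refl)
  ⟦⟧-cong-≈ (s ∧ₜ t) h = ∧-cong-≈ (⟦⟧-cong-≈ s (h ∘ ∈-++⁺ˡ)) (⟦⟧-cong-≈ t (h ∘ ∈-++⁺ʳ _))
  ⟦⟧-cong-≈ (s ∨ₜ t) h = ∨-cong-≈ (⟦⟧-cong-≈ s (h ∘ ∈-++⁺ˡ)) (⟦⟧-cong-≈ t (h ∘ ∈-++⁺ʳ _))
  ⟦⟧-cong-≈ (s ⇒ₜ t) h = ⇒-cong-≈ (⟦⟧-cong-≈ s (h ∘ ∈-++⁺ˡ)) (⟦⟧-cong-≈ t (h ∘ ∈-++⁺ʳ _))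
  ⟦⟧-cong-≈ 𝟘ₜ       h = refl
  ⟦⟧-cong-≈ 𝟙ₜ       h = refl

  ∧-split : ∀ {x x′} → x ∨ x′ ≡ 𝟙 → ∀ e y → e ∧ y ≡ ((e ∧ x) ∧ y) ∨ ((e ∧ x′) ∧ y)
  ∧-split {x} {x′} x∨x′≡𝟙 e y = begin
    e ∧ y                              ≡⟨ ∧-identityʳ (e ∧ y) ⟨
    (e ∧ y) ∧ 𝟙                        ≡⟨ cong ((e ∧ y) ∧_) x∨x′≡𝟙 ⟨
    (e ∧ y) ∧ (x ∨ x′)                 ≡⟨ ∧-distribˡ-∨ (e ∧ y) x x′ ⟩
    ((e ∧ y) ∧ x) ∨ ((e ∧ y) ∧ x′)     ≡⟨ cong₂ _∨_ (xy∙z≈xz∙y e y x) (xy∙z≈xz∙y e y x′) ⟩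
    ((e ∧ x) ∧ y) ∨ ((e ∧ x′) ∧ y)     ∎

  ≈-split : ∀ {x x′ e y z} → x ∨ x′ ≡ 𝟙 → y ≈[ e ∧ x ] z → y ≈[ e ∧ x′ ] z → y ≈[ e ] z
  ≈-split {e = e} {y} {z} x∨x′≡𝟙 y≈z y≈′z =
    trans (∧-split x∨x′≡𝟙 e y) (trans (cong₂ _∨_ y≈z y≈′z) (sym (∧-split x∨x′≡𝟙 e z)))

  x≈[e∧x]𝟙 : ∀ e x → x ≈[ e ∧ x ] 𝟙
  x≈[e∧x]𝟙 e x = begin
    (e ∧ x) ∧ x  ≡⟨ ∧-assoc e x x ⟩
    e ∧ (x ∧ x)  ≡⟨ cong (e ∧_) (∧-idem x) ⟩
    e ∧ x        ≡⟨ ∧-identityʳ (e ∧ x) ⟨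
    (e ∧ x) ∧ 𝟙  ∎

  x≈[e∧x*]𝟘 : ∀ e x → x ≈[ e ∧ x * ] 𝟘
  x≈[e∧x*]𝟘 e x = begin
    (e ∧ x *) ∧ x  ≡⟨ xy∙z≈xz∙y e (x *) x ⟩
    (e ∧ x) ∧ x *  ≡⟨ ∧-assoc e x (x *) ⟩
    e ∧ (x ∧ x *)  ≡⟨ cong (e ∧_) (trans (sh₁ x 𝟘) (∧-zeroʳ x)) ⟩
    e ∧ 𝟘          ≡⟨ ∧-zeroʳ e ⟩
    𝟘              ≡⟨ ∧-zeroʳ (e ∧ x *) ⟨
    (e ∧ x *) ∧ 𝟘  ∎

  emb : Bool → Carrier
  emb false = 𝟘
  emb true  = 𝟙

  emb-∧ : ∀ b c → emb b ∧ emb c ≡ emb (b B.∧ c)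
  emb-∧ false c = 𝟘-bottom (emb c)
  emb-∧ true  c = ∧-identityˡ (emb c)

  emb-∨ : ∀ b c → emb b ∨ emb c ≡ emb (b B.∨ c)
  emb-∨ false c = ∨-identityˡ (emb c)
  emb-∨ true  c = 𝟙-top (emb c)

  module _ (𝟘⇒𝟙≡𝟘 : 𝟘 ⇒ 𝟙 ≡ 𝟘) where

    emb-⇒ : ∀ b c → emb b ⇒ emb c ≡ emb (b ⇒₂ c)
    emb-⇒ false false = sh₃ 𝟘
    emb-⇒ false true  = 𝟘⇒𝟙≡𝟘
    emb-⇒ true  false = ⇒-identityˡ 𝟘
    emb-⇒ true  true  = sh₃ 𝟙

    ⟦⟧-emb : ∀ t σ → ⟦ t ⟧ᴬ (emb ∘ σ) ≡ emb (⟦ t ⟧₂ σ)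
    ⟦⟧-emb (var i)  σ = refl
    ⟦⟧-emb (s ∧ₜ t) σ = trans (cong₂ _∧_ (⟦⟧-emb s σ) (⟦⟧-emb t σ)) (emb-∧ (⟦ s ⟧₂ σ) (⟦ t ⟧₂ σ))
    ⟦⟧-emb (s ∨ₜ t) σ = trans (cong₂ _∨_ (⟦⟧-emb s σ) (⟦⟧-emb t σ)) (emb-∨ (⟦ s ⟧₂ σ) (⟦ t ⟧₂ σ))
    ⟦⟧-emb (s ⇒ₜ t) σ = trans (cong₂ _⇒_ (⟦⟧-emb s σ) (⟦⟧-emb t σ)) (emb-⇒ (⟦ s ⟧₂ σ) (⟦ t ⟧₂ σ))
    ⟦⟧-emb 𝟘ₜ       σ = refl
    ⟦⟧-emb 𝟙ₜ       σ = refl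

    module _ (∨-complementʳ : ∀ x → x ∨ x * ≡ 𝟙)
             (s t : Term) (s≈t : 2̄ ⊨ s ≈ t) (ρ : ℕ → Carrier) where

      AgreeOn : Carrier → (ℕ → Bool) → ℕ → Set a
      AgreeOn e σ i = ρ i ≈[ e ] emb (σ i)

      ≈-if-agree : ∀ {e} σ → (∀ {i} → i ∈ vars s ++ vars t → AgreeOn e σ i) →
                   ⟦ s ⟧ᴬ ρ ≈[ e ] ⟦ t ⟧ᴬ ρ
      ≈-if-agree {e} σ agree = begin
        e ∧ ⟦ s ⟧ᴬ ρ          ≡⟨ ⟦⟧-cong-≈ s (agree ∘ ∈-++⁺ˡ) ⟩
        e ∧ ⟦ s ⟧ᴬ (emb ∘ σ)  ≡⟨ cong (e ∧_) (⟦⟧-emb s σ) ⟩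
        e ∧ emb (⟦ s ⟧₂ σ)    ≡⟨ cong (λ b → e ∧ emb b) (s≈t σ) ⟩
        e ∧ emb (⟦ t ⟧₂ σ)    ≡⟨ cong (e ∧_) (⟦⟧-emb t σ) ⟨
        e ∧ ⟦ t ⟧ᴬ (emb ∘ σ)  ≡⟨ ⟦⟧-cong-≈ t (agree ∘ ∈-++⁺ʳ (vars s)) ⟨
        e ∧ ⟦ t ⟧ᴬ ρ          ∎

      AgreeOutside : List ℕ → Carrier → (ℕ → Bool) → Set a
      AgreeOutside U e σ = ∀ {i} → i ∈ vars s ++ vars t → i ∉ U → AgreeOn e σ i

      agreeOutside-refine : ∀ {j U e σ} f b → ρ j ≈[ e ∧ f ] emb b →
                            AgreeOutside (j ∷ U) e σ → AgreeOutside U (e ∧ f) (σ [ j ≔ b ])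
      agreeOutside-refine {j} f b ρj≈b agree {i} i∈vars i∉U with i ≟ j
      ... | yes refl = ρj≈b
      ... | no  i≢j  = ≈-restrict f (agree i∈vars λ { (here i≡j)  → i≢j i≡j
                                                     ; (there i∈U) → i∉U i∈U })

      ≈-if-agreeOutside : ∀ U {e} σ → AgreeOutside U e σ → ⟦ s ⟧ᴬ ρ ≈[ e ] ⟦ t ⟧ᴬ ρ
      ≈-if-agreeOutside []      σ agree = ≈-if-agree σ (λ i∈vars → agree i∈vars λ ())
      ≈-if-agreeOutside (j ∷ U) {e} σ agree = ≈-split (∨-complementʳ (ρ j))
        (≈-if-agreeOutside U (σ [ j ≔ true ])
          (agreeOutside-refine (ρ j) true (x≈[e∧x]𝟙 e (ρ j)) agree))
        (≈-if-agreeOutside U (σ [ j ≔ false ])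
          (agreeOutside-refine (ρ j *) false (x≈[e∧x*]𝟘 e (ρ j)) agree))

  complemented⇒antiBoolean : 𝟘 ⇒ 𝟙 ≡ 𝟘 → (∀ x → x ∨ x * ≡ 𝟙) → IsAntiBoolean A
  complemented⇒antiBoolean 𝟘⇒𝟙≡𝟘 ∨-complementʳ s t s≈t ρ =
    ≈[𝟙]⇒≡ (≈-if-agreeOutside 𝟘⇒𝟙≡𝟘 ∨-complementʳ s t s≈t ρ (vars s ++ vars t) (λ _ → true)
             (λ i∈vars i∉vars → contradiction i∈vars i∉vars))

theorem7p4 : ∀ {a : Level} (A : SemiHeytingAlgebra a) →
    IsAntiBoolean A ⇔
      ((∀ x → let open SemiHeytingAlgebra A in ((x *) ⇒ x) * ≡ 𝟙) ×
       (∀ x y → let open SemiHeytingAlgebra A in (x *) ∨ (y *) ∨ (x ⇒ y) ≡ 𝟙))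
theorem7p4 A = mk⇔ (antiBoolean⇒identities A) λ (identity-i , identity-ii) →
  complemented⇒antiBoolean A (identity-i⇒𝟘⇒𝟙≡𝟘 A identity-i) (identity-ii⇒∨-complementʳ A identity-ii)
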